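{- Let $r\ge 3$, $n\in \mathbb{N}$, $0\leq \delta\leq 1/(2r)$, and let $G$ be an $r$-partite graph on $(V_1,\ldots,V_r)$, where $|V_1|=\ldots=|V_r|=n$ and $\hat{\delta}(G)\geq (1-\delta)n$. Then, for each $I\subset[r]$ and $i\in I$, \[k_I/n\leq k_{I\setminus\{i\}}\leq (1+2\delta r)k_I/n.\]
   Context: An $r$-partite graph $G$ on $(V_1,\ldots,V_r)$ has vertex set partitioned into $V_1,\ldots,V_r$ with no edge inside any $V_i$. $d(v,X)$ is the number of neighbours of $v$ in $X$; $\hat{\delta}(G)=\min\{d(v,V_j): j\in[r], v\in V(G)\setminus V_j\}$. For $I\subset[r]$, $\mathcal{K}_I$ is the set of $|I|$-cliques in $G$ having exactly one vertex in $V_i$ for each $i\in I$, and $k_I=|\mathcal{K}_I|$ (with $k_\emptyset=1$, the empty clique).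
   Formalization: The parameter δ ranges over the rationals. -}

module Defs where

open import Data.Nat using (ℕ; zero; suc)
open import Data.Bool using (Bool; true; false; _∧_; if_then_else_)
open import Data.Fin using (Fin; _≟_)
open import Data.Fin.Subset using (Subset)
open import Data.Vec using (Vec; []; _∷_; lookup)
open import Data.List using (List; []; _∷_; [_]; map; concatMap; filter; length; allFin)
open import Data.Maybe using (Maybe; just; nothing)
open import Relation.Binary.PropositionalEquality using (_≡_)
open import Relation.Nullary.Decidable using (⌊_⌋)
open import Relation.Unary using (Pred)
open import Data.Bool.Properties using (T?)
open import Data.Integer using (+_)
open import Data.Rational using (ℚ; _/_; _≤_; _*_; _-_; 1ℚ)
open import Relation.Nullary using (¬_)

allB : {A : Set} → (A → Bool) → List A → Bool
allB p []       = true
allB p (x ∷ xs) = p x ∧ allB p xs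

-- An r-partite graph with parts V_1..V_r, each of size n.
-- The vertex (i , a) is the a-th vertex of part V_i.
-- adj i a j b = true iff (i,a) and (j,b) are adjacent.
record RPartiteGraph (r n : ℕ) : Set where
  field
    adj       : Fin r → Fin n → Fin r → Fin n → Bool
    symmetric : ∀ i a j b → adj i a j b ≡ adj j b i a
    partite   : ∀ i a b → adj i a i b ≡ false
open RPartiteGraph public

countFin : (n : ℕ) → (Fin n → Bool) → ℕ
countFin n p = length (filter (λ x → T? (p x)) (allFin n))

deg : ∀ {r n} → RPartiteGraph r n → Fin r → Fin n → Fin r → ℕ
deg {n = n} G i a j = countFin n (λ b → adj G i a j b)

-- min-degree condition  \hat δ(G) ≥ (1 - δ) n, as rationals:
-- for every part j and every vertex v = (i,a) with i ≠ j, (1 - δ) n ≤ d(v, V_j)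
MinPartDegreeAtLeast : ∀ {r n} → RPartiteGraph r n → ℚ → Set
MinPartDegreeAtLeast {r} {n} G δ =
  ∀ (i j : Fin r) (a : Fin n) → ¬ (i ≡ j) →
    (1ℚ - δ) * ((+ n) / 1) ≤ (+ deg G i a j) / 1

-- All choices of one vertex (index in Fin n) in V_i for each i ∈ I
-- (nothing at positions outside I).  Each choice appears exactly once.
selections : ∀ {r} (n : ℕ) → Subset r → List (Vec (Maybe (Fin n)) r)
selections n []          = [ [] ]
selections n (true ∷ I)  = concatMap (λ s → map (λ a → just a ∷ s) (allFin n)) (selections n I)
selections n (false ∷ I) = map (nothing ∷_) (selections n I)

isClique : ∀ {r n} → RPartiteGraph r n → Vec (Maybe (Fin n)) r → Bool
isClique {r} G s = allB (λ i → allB (λ j → ok i j (lookup s i) (lookup s j)) (allFin r)) (allFin r)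
  where
  ok : Fin r → Fin r → Maybe _ → Maybe _ → Bool
  ok i j (just a) (just b) = if ⌊ i ≟ j ⌋ then true else adj G i a j b
  ok i j _ _ = true

-- k_I = |𝒦_I| : number of |I|-cliques with exactly one vertex in V_i for each i ∈ I
-- (k_∅ = 1, the empty clique)
k : ∀ {r n} → RPartiteGraph r n → Subset r → ℕ
k G I = length (filter (λ s → T? (isClique G s)) (selections _ I))

-- Every clique of 𝒦_I is obtained from exactly one clique S of 𝒦_{I∖{i}} by adding a
-- vertex of V_i adjacent to all of S, so k_I is the sum over S of the number ext(S) of
-- such vertices.  Trivially ext(S) ≤ n.  Each of the at most r vertices of S has at most
-- δn non-neighbours in V_i, so ext(S) ≥ (1 - δr)n, and (1 + 2δr)(1 - δr) ≥ 1 as 2δr ≤ 1.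

module Submission where

open import Defs
open import Data.Nat renaming (_≤_ to _≤ℕ_; _*_ to _*ℕ_) using (ℕ)
open import Data.Product using (_×_)
open import Data.Fin using (Fin)
open import Data.Fin.Subset using (Subset; _∈_; _-_)
open import Data.Integer using (+_)
open import Data.Rational using (ℚ; 0ℚ; 1ℚ; _/_; _+_; _*_; _≤_)

import Data.Nat as ℕ
import Data.Nat.Properties as ℕₚ
open import Algebra.Properties.CommutativeSemigroup ℕₚ.+-commutativeSemigroup using (interchange)
open import Data.Nat.Coprimality using (1-coprimeTo) renaming (sym to coprime-sym)
import Data.Integer as ℤ
import Data.Integer.Properties as ℤₚ
import Data.Rational as ℚ
open import Data.Rational using (mkℚ; *≤*; nonNegative)
open import Data.Rational.Properties
open import Data.Rational.Solver using (module +-*-Solver)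
open import Data.Fin using (zero; suc) renaming (_≟_ to _≟ᶠ_)
open import Data.Fin.Subset using (inside; outside)
open import Data.Fin.Subset.Properties using (p─⊥≡p)
open import Data.Bool using (Bool; true; false; not; if_then_else_)
open import Data.Bool.Properties using (T?)
open import Data.Maybe using (Maybe; just; nothing)
open import Data.Vec using (Vec; []; _∷_; lookup; _[_]≔_; here; there)
open import Data.Vec.Properties using (lookup∘update; lookup∘update′)
open import Data.List using (List; []; _∷_; map; concatMap; filter; length; allFin; _++_)
open import Data.List.Properties using (length-tabulate)
open import Data.List.Relation.Unary.All as All using (All; []; _∷_)
open import Data.List.Relation.Unary.All.Properties using (map⁺; concat⁺)
open import Data.List.Membership.Propositional using () renaming (_∈_ to _∈ₗ_)
open import Data.List.Membership.Propositional.Properties using (∈-allFin)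
open import Data.List.Relation.Unary.Any using (here; there)
open import Data.Product using (∃-syntax; _,_)
open import Data.Empty using (⊥-elim)
open import Relation.Nullary using (yes; no)
open import Relation.Nullary.Decidable using (⌊_⌋)
open import Relation.Binary.PropositionalEquality

private
  variable
    A B : Set

∑ : List A → (A → ℕ) → ℕ
∑ []       f = 0
∑ (x ∷ xs) f = f x ℕ.+ ∑ xs f

syntax ∑ xs (λ x → e) = ∑[ x ← xs ] e

∑-cong : ∀ xs {f g : A → ℕ} → (∀ x → f x ≡ g x) → ∑ xs f ≡ ∑ xs g
∑-cong []       f≗g = refl
∑-cong (x ∷ xs) f≗g = cong₂ ℕ._+_ (f≗g x) (∑-cong xs f≗g)

∑-mono-All : ∀ {xs} {f g : A → ℕ} → All (λ x → f x ≤ℕ g x) xs → ∑ xs f ≤ℕ ∑ xs g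
∑-mono-All []           = ℕ.z≤n
∑-mono-All (fx≤gx ∷ hs) = ℕₚ.+-mono-≤ fx≤gx (∑-mono-All hs)

∑-mono : ∀ xs {f g : A → ℕ} → (∀ x → f x ≤ℕ g x) → ∑ xs f ≤ℕ ∑ xs g
∑-mono xs f≤g = ∑-mono-All (All.universal f≤g xs)

∑-+ : ∀ xs (f g : A → ℕ) → ∑[ x ← xs ] (f x ℕ.+ g x) ≡ ∑ xs f ℕ.+ ∑ xs g
∑-+ []       f g = refl
∑-+ (x ∷ xs) f g = trans (cong (f x ℕ.+ g x ℕ.+_) (∑-+ xs f g)) (interchange (f x) (g x) _ _)

∑-const : ∀ (xs : List A) c → ∑[ x ← xs ] c ≡ length xs *ℕ c
∑-const []       c = refl
∑-const (x ∷ xs) c = cong (c ℕ.+_) (∑-const xs c)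

*-distribˡ-∑ : ∀ c xs (f : A → ℕ) → c *ℕ ∑ xs f ≡ ∑[ x ← xs ] (c *ℕ f x)
*-distribˡ-∑ c []       f = ℕₚ.*-zeroʳ c
*-distribˡ-∑ c (x ∷ xs) f =
  trans (ℕₚ.*-distribˡ-+ c (f x) (∑ xs f)) (cong (c *ℕ f x ℕ.+_) (*-distribˡ-∑ c xs f))

∑-++ : ∀ xs ys (f : A → ℕ) → ∑ (xs ++ ys) f ≡ ∑ xs f ℕ.+ ∑ ys f
∑-++ []       ys f = refl
∑-++ (x ∷ xs) ys f = trans (cong (f x ℕ.+_) (∑-++ xs ys f)) (sym (ℕₚ.+-assoc (f x) _ _))

∑-map : ∀ (h : B → A) ys (f : A → ℕ) → ∑ (map h ys) f ≡ ∑[ y ← ys ] (f (h y))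
∑-map h []       f = refl
∑-map h (y ∷ ys) f = cong (f (h y) ℕ.+_) (∑-map h ys f)

∑-concatMap : ∀ (g : B → List A) ys (f : A → ℕ) → ∑ (concatMap g ys) f ≡ ∑[ y ← ys ] (∑ (g y) f)
∑-concatMap g []       f = refl
∑-concatMap g (y ∷ ys) f = trans (∑-++ (g y) _ f) (cong (∑ (g y) f ℕ.+_) (∑-concatMap g ys f))

∑-comm : ∀ xs (ys : List B) (f : A → B → ℕ) →
         ∑[ x ← xs ] (∑ ys (f x)) ≡ ∑[ y ← ys ] (∑[ x ← xs ] (f x y))
∑-comm []       ys f = sym (trans (∑-const ys 0) (ℕₚ.*-zeroʳ (length ys)))
∑-comm (x ∷ xs) ys f = trans (cong (∑ ys (f x) ℕ.+_) (∑-comm xs ys f)) (sym (∑-+ ys (f x) _))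

length-allFin : ∀ n → length (allFin n) ≡ n
length-allFin n = length-tabulate (λ x → x)

∑-allFin-const : ∀ n c → ∑[ a ← allFin n ] c ≡ n *ℕ c
∑-allFin-const n c = trans (∑-const (allFin n) c) (cong (_*ℕ c) (length-allFin n))

𝟙 : Bool → ℕ
𝟙 true  = 1
𝟙 false = 0

𝟙-mono : ∀ {b c} → (b ≡ true → c ≡ true) → 𝟙 b ≤ℕ 𝟙 c
𝟙-mono {false} b⇒c = ℕ.z≤n
𝟙-mono {true}  b⇒c rewrite b⇒c refl = ℕₚ.≤-refl

length-filter : ∀ (p : A → Bool) xs → length (filter (λ x → T? (p x)) xs) ≡ ∑[ x ← xs ] (𝟙 (p x))
length-filter p []       = refl
length-filter p (x ∷ xs) with p x
... | true  = cong ℕ.suc (length-filter p xs)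
... | false = length-filter p xs

∑-𝟙-not+∑-𝟙 : ∀ (p : A → Bool) xs →
              ∑[ x ← xs ] (𝟙 (not (p x))) ℕ.+ ∑[ x ← xs ] (𝟙 (p x)) ≡ length xs
∑-𝟙-not+∑-𝟙 p []       = refl
∑-𝟙-not+∑-𝟙 p (x ∷ xs) with p x
... | true  = trans (ℕₚ.+-suc _ _) (cong ℕ.suc (∑-𝟙-not+∑-𝟙 p xs))
... | false = cong ℕ.suc (∑-𝟙-not+∑-𝟙 p xs)

𝟙-not-allB≤∑-𝟙-not : ∀ (p : A → Bool) xs → 𝟙 (not (allB p xs)) ≤ℕ ∑[ x ← xs ] (𝟙 (not (p x)))
𝟙-not-allB≤∑-𝟙-not p []       = ℕ.z≤n
𝟙-not-allB≤∑-𝟙-not p (x ∷ xs) with p x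
... | true  = 𝟙-not-allB≤∑-𝟙-not p xs
... | false = ℕ.s≤s ℕ.z≤n

allB-true : ∀ {p : A → Bool} {xs} → allB p xs ≡ true → ∀ {x} → x ∈ₗ xs → p x ≡ true
allB-true {p = p} {y ∷ xs} h (here refl) with p y
... | true = refl
allB-true {p = p} {y ∷ xs} h (there x∈xs) with p y
... | true = allB-true h x∈xs

allB-false : ∀ {p : A → Bool} {xs} → allB p xs ≡ false → ∃[ x ] p x ≡ false
allB-false {p = p} {y ∷ xs} h with p y in py
... | true  = allB-false {xs = xs} h
... | false = y , py

fromℕ : ℕ → ℚ
fromℕ n = + n / 1

fromℕ≡mkℚ : ∀ n → fromℕ n ≡ mkℚ (+ n) 0 (coprime-sym (1-coprimeTo n))
fromℕ≡mkℚ n = normalize-coprime (coprime-sym (1-coprimeTo n))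

fromℕ-+ : ∀ m n → fromℕ (m ℕ.+ n) ≡ fromℕ m + fromℕ n
fromℕ-+ m n = begin
  + (m ℕ.+ n) / 1
    ≡⟨ cong (_/ 1) (sym (cong₂ ℤ._+_ (ℤₚ.*-identityʳ (+ m)) (ℤₚ.*-identityʳ (+ n)))) ⟩
  (+ m ℤ.* + 1 ℤ.+ + n ℤ.* + 1) / 1
    ≡⟨ sym (cong₂ _+_ (fromℕ≡mkℚ m) (fromℕ≡mkℚ n)) ⟩
  fromℕ m + fromℕ n
    ∎
  where open ≡-Reasoning

fromℕ-* : ∀ m n → fromℕ (m *ℕ n) ≡ fromℕ m * fromℕ n
fromℕ-* m n = begin
  + (m *ℕ n) / 1     ≡⟨ cong (_/ 1) (ℤₚ.pos-* m n) ⟩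
  (+ m ℤ.* + n) / 1  ≡⟨ sym (cong₂ _*_ (fromℕ≡mkℚ m) (fromℕ≡mkℚ n)) ⟩
  fromℕ m * fromℕ n  ∎
  where open ≡-Reasoning

fromℕ-mono-≤ : ∀ {m n} → m ≤ℕ n → fromℕ m ≤ fromℕ n
fromℕ-mono-≤ {m} {n} m≤n rewrite fromℕ≡mkℚ m | fromℕ≡mkℚ n =
  *≤* (ℤₚ.*-monoʳ-≤-nonNeg (+ 1) (ℤ.+≤+ m≤n))

0≤fromℕ : ∀ n → 0ℚ ≤ fromℕ n
0≤fromℕ n = fromℕ-mono-≤ {0} {n} ℕ.z≤n

fromℕ-*𝟙-≤ : ∀ {n c q} b → 0ℚ ≤ q * fromℕ c → (b ≡ true → fromℕ n ≤ q * fromℕ c) →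
             fromℕ (n *ℕ 𝟙 b) ≤ q * fromℕ c
fromℕ-*𝟙-≤ {n} {c} {q} false 0≤qc _ = subst (λ m → fromℕ m ≤ q * fromℕ c) (sym (ℕₚ.*-zeroʳ n)) 0≤qc
fromℕ-*𝟙-≤ {n} {c} {q} true  _ n≤qc = subst (λ m → fromℕ m ≤ q * fromℕ c) (sym (ℕₚ.*-identityʳ n)) (n≤qc refl)

fromℕ-∑-≤ : ∀ {xs : List A} {f g : A → ℕ} q →
            All (λ x → fromℕ (f x) ≤ q * fromℕ (g x)) xs → fromℕ (∑ xs f) ≤ q * fromℕ (∑ xs g)
fromℕ-∑-≤ q [] = ≤-reflexive (sym (*-zeroʳ q))
fromℕ-∑-≤ {xs = x ∷ xs} {f} {g} q (fx≤qgx ∷ hs) = begin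
  fromℕ (f x ℕ.+ ∑ xs f)                  ≡⟨ fromℕ-+ (f x) (∑ xs f) ⟩
  fromℕ (f x) + fromℕ (∑ xs f)            ≤⟨ +-mono-≤ fx≤qgx (fromℕ-∑-≤ q hs) ⟩
  q * fromℕ (g x) + q * fromℕ (∑ xs g)    ≡⟨ sym (*-distribˡ-+ q _ _) ⟩
  q * (fromℕ (g x) + fromℕ (∑ xs g))      ≡⟨ cong (q *_) (sym (fromℕ-+ (g x) (∑ xs g))) ⟩
  q * fromℕ (g x ℕ.+ ∑ xs g)              ∎
  where open ≤-Reasoning

open +-*-Solver

0≤* : ∀ {p q} → 0ℚ ≤ p → 0ℚ ≤ q → 0ℚ ≤ p * q
0≤* {p} {q} 0≤p 0≤q =
  nonNegative⁻¹ (p * q) {{nonNeg*nonNeg⇒nonNeg p {{nonNegative 0≤p}} q {{nonNegative 0≤q}}}}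

x+y≡z∧[1-δ]z≤y⇒x≤δz : ∀ {x y z δ} → x + y ≡ z → (1ℚ ℚ.- δ) * z ≤ y → x ≤ δ * z
x+y≡z∧[1-δ]z≤y⇒x≤δz {x} {y} {z} {δ} x+y≡z [1-δ]z≤y = begin
  x                     ≡⟨ solve 2 (λ x y → x := x :+ y :- y) refl x y ⟩
  x + y ℚ.- y           ≡⟨ cong (ℚ._- y) x+y≡z ⟩
  z ℚ.- y               ≤⟨ +-monoʳ-≤ z (neg-antimono-≤ [1-δ]z≤y) ⟩
  z ℚ.- (1ℚ ℚ.- δ) * z  ≡⟨ solve 2 (λ z δ → z :- (con 1ℚ :- δ) :* z := δ :* z) refl z δ ⟩
  δ * z                 ∎
  where open ≤-Reasoning

0≤1+2δr : ∀ {δ r} → 0ℚ ≤ δ → 0ℚ ≤ r → 0ℚ ≤ 1ℚ + fromℕ 2 * δ * r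
0≤1+2δr 0≤δ 0≤r = +-mono-≤ (0≤fromℕ 1) (0≤* (0≤* (0≤fromℕ 2) 0≤δ) 0≤r)

-- With y = δr: from n - yn ≤ c, we get (1 + 2y) c ≥ (1 + 2y)(1 - y) n = n + y(1 - 2y) n ≥ n.
n≤c+δnr⇒n≤[1+2δr]c : ∀ {δ r n c} → 0ℚ ≤ δ → 0ℚ ≤ r → 0ℚ ≤ n → fromℕ 2 * r * δ ≤ 1ℚ →
                     n ≤ c + δ * n * r → n ≤ (1ℚ + fromℕ 2 * δ * r) * c
n≤c+δnr⇒n≤[1+2δr]c {δ} {r} {n} {c} 0≤δ 0≤r 0≤n 2rδ≤1 n≤c+δnr = begin
  n                                         ≡⟨ sym (+-identityʳ n) ⟩
  n + 0ℚ                                    ≤⟨ +-monoʳ-≤ n (0≤* (0≤* (0≤* 0≤δ 0≤r) 0≤1-2rδ) 0≤n) ⟩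
  n + δ * r * (1ℚ ℚ.- fromℕ 2 * r * δ) * n  ≡⟨ expand ⟩
  1+2δr * (n ℚ.- δ * n * r)                 ≤⟨ *-monoˡ-≤-nonNeg 1+2δr {{nonNegative (0≤1+2δr 0≤δ 0≤r)}} n-δnr≤c ⟩
  1+2δr * c                                 ∎
  where
  open ≤-Reasoning
  1+2δr : ℚ
  1+2δr = 1ℚ + fromℕ 2 * δ * r
  expand : n + δ * r * (1ℚ ℚ.- fromℕ 2 * r * δ) * n ≡ 1+2δr * (n ℚ.- δ * n * r)
  expand = solve 3 (λ δ r n → n :+ δ :* r :* (con 1ℚ :- con (fromℕ 2) :* r :* δ) :* n
                           := (con 1ℚ :+ con (fromℕ 2) :* δ :* r) :* (n :- δ :* n :* r)) refl δ r n
  0≤1-2rδ : 0ℚ ≤ 1ℚ ℚ.- fromℕ 2 * r * δ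
  0≤1-2rδ = subst (_≤ 1ℚ ℚ.- fromℕ 2 * r * δ) (+-inverseʳ (fromℕ 2 * r * δ)) (+-monoˡ-≤ _ 2rδ≤1)
  n-δnr≤c : n ℚ.- δ * n * r ≤ c
  n-δnr≤c = subst (n ℚ.- δ * n * r ≤_) (solve 2 (λ c t → c :+ t :- t := c) refl c (δ * n * r))
                  (+-monoˡ-≤ _ n≤c+δnr)

compatible : ∀ {r n} → RPartiteGraph r n → Fin r → Fin r → Maybe (Fin n) → Maybe (Fin n) → Bool
compatible G j l (just a) (just b) = if ⌊ j ≟ᶠ l ⌋ then true else adj G j a l b
compatible G j l _        _        = true

IsClique : ∀ {r n} → RPartiteGraph r n → Vec (Maybe (Fin n)) r → Set
IsClique G s = ∀ j l → compatible G j l (lookup s j) (lookup s l) ≡ true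

-- compatible repeats the local function of isClique, which cannot be named; case
-- splitting on the two chosen vertices makes both compute to the same value.
isClique⇒IsClique : ∀ {r n} (G : RPartiteGraph r n) s → isClique G s ≡ true → IsClique G s
isClique⇒IsClique G s h j l with lookup s j | lookup s l | allB-true (allB-true h (∈-allFin j)) (∈-allFin l)
... | just a  | just b  | e = e
... | just a  | nothing | _ = refl
... | nothing | _       | _ = refl

IsClique⇒isClique : ∀ {r n} (G : RPartiteGraph r n) s → IsClique G s → isClique G s ≡ true
IsClique⇒isClique G s clique with isClique G s in e
... | true  = refl
... | false with allB-false {xs = allFin _} e
...   | j , e₁ with allB-false {xs = allFin _} e₁
...     | l , e₂ with lookup s j | lookup s l | clique j l | e₂
...       | just a  | just b  | c | e₃ = trans (sym e₃) c
...       | just a  | nothing | c | e₃ = trans (sym e₃) c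
...       | nothing | _       | c | e₃ = trans (sym e₃) c

compatible-refl : ∀ {r n} (G : RPartiteGraph r n) j a b → compatible G j j (just a) (just b) ≡ true
compatible-refl G j a b with j ≟ᶠ j
... | yes _  = refl
... | no j≢j = ⊥-elim (j≢j refl)

nothing≢just : ∀ {x : A} → nothing ≢ just x
nothing≢just ()

adjacentToChosen : ∀ {r n} → RPartiteGraph r n → Fin r → Fin n → Fin r → Maybe (Fin n) → Bool
adjacentToChosen G i a j nothing  = true
adjacentToChosen G i a j (just b) = adj G j b i a

module _ {r n} (G : RPartiteGraph r n) (i : Fin r) (s : Vec (Maybe (Fin n)) r)
         (s-i≡nothing : lookup s i ≡ nothing) (a : Fin n) where

  private
    lookup-at-i : lookup (s [ i ]≔ just a) i ≡ just a
    lookup-at-i = lookup∘update i s (just a)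

    lookup-off-i : ∀ {j} → j ≢ i → lookup (s [ i ]≔ just a) j ≡ lookup s j
    lookup-off-i j≢i = lookup∘update′ j≢i s (just a)

    lookup-chosen : ∀ {j b} → lookup s j ≡ just b → lookup (s [ i ]≔ just a) j ≡ just b
    lookup-chosen {j} s-j≡b with j ≟ᶠ i
    ... | yes refl = ⊥-elim (nothing≢just (trans (sym s-i≡nothing) s-j≡b))
    ... | no j≢i   = trans (lookup-off-i j≢i) s-j≡b

  IsClique-shrink : IsClique G (s [ i ]≔ just a) → IsClique G s
  IsClique-shrink clique j l with lookup s j in s-j | lookup s l in s-l
  ... | nothing | _       = refl
  ... | just b  | nothing = refl
  ... | just b  | just c  =
    subst₂ (λ x y → compatible G j l x y ≡ true) (lookup-chosen s-j) (lookup-chosen s-l) (clique j l)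

  IsClique-extend : IsClique G s → (∀ j → adjacentToChosen G i a j (lookup s j) ≡ true) →
                    IsClique G (s [ i ]≔ just a)
  IsClique-extend clique adjacent j l with j ≟ᶠ i | l ≟ᶠ i
  ... | yes refl | yes refl rewrite lookup-at-i = compatible-refl G i a a
  ... | yes refl | no l≢i   rewrite lookup-at-i | lookup-off-i l≢i = new-compatible l
    where
    new-compatible : ∀ l → compatible G i l (just a) (lookup s l) ≡ true
    new-compatible l with lookup s l | adjacent l
    ... | nothing | _        = refl
    ... | just c  | adjacent-l with i ≟ᶠ l
    ...   | yes _ = refl
    ...   | no _  = trans (symmetric G i a l c) adjacent-l
  ... | no j≢i   | yes refl rewrite lookup-at-i | lookup-off-i j≢i = compatible-new j
    where
    compatible-new : ∀ j → compatible G j i (lookup s j) (just a) ≡ true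
    compatible-new j with lookup s j | adjacent j
    ... | nothing | _          = refl
    ... | just b  | adjacent-j with j ≟ᶠ i
    ...   | yes _ = refl
    ...   | no _  = adjacent-j
  ... | no j≢i   | no l≢i   rewrite lookup-off-i j≢i | lookup-off-i l≢i = clique j l

-- Extending a clique by a vertex of V_i

module _ {r n} (G : RPartiteGraph r n) (i : Fin r) where

  extensions : Vec (Maybe (Fin n)) r → ℕ
  extensions s = ∑[ a ← allFin n ] (𝟙 (isClique G (s [ i ]≔ just a)))

  nonNeighbours : Vec (Maybe (Fin n)) r → Fin r → ℕ
  nonNeighbours s j = ∑[ a ← allFin n ] (𝟙 (not (adjacentToChosen G i a j (lookup s j))))

  extensions≤n*𝟙 : ∀ s → lookup s i ≡ nothing → extensions s ≤ℕ n *ℕ 𝟙 (isClique G s)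
  extensions≤n*𝟙 s s-i≡nothing =
    ℕₚ.≤-trans (∑-mono (allFin n) shrink) (ℕₚ.≤-reflexive (∑-allFin-const n _))
    where
    shrink : ∀ a → 𝟙 (isClique G (s [ i ]≔ just a)) ≤ℕ 𝟙 (isClique G s)
    shrink a = 𝟙-mono λ clique⁺ →
      IsClique⇒isClique G s (IsClique-shrink G i s s-i≡nothing a (isClique⇒IsClique G (s [ i ]≔ just a) clique⁺))

  n≤extensions+∑nonNeighbours : ∀ s → lookup s i ≡ nothing → isClique G s ≡ true →
                                n ≤ℕ extensions s ℕ.+ ∑[ j ← allFin r ] (nonNeighbours s j)
  n≤extensions+∑nonNeighbours s s-i≡nothing clique = begin
    n
      ≡⟨ sym (trans (∑-allFin-const n 1) (ℕₚ.*-identityʳ n)) ⟩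
    ∑[ a ← allFin n ] 1
      ≤⟨ ∑-mono (allFin n) extends-or-blocked ⟩
    ∑[ a ← allFin n ] (𝟙 (isClique G (s [ i ]≔ just a)) ℕ.+ blocked a)
      ≡⟨ ∑-+ (allFin n) _ blocked ⟩
    extensions s ℕ.+ ∑[ a ← allFin n ] (blocked a)
      ≡⟨ cong (extensions s ℕ.+_) (∑-comm (allFin n) (allFin r) _) ⟩
    extensions s ℕ.+ ∑[ j ← allFin r ] (nonNeighbours s j)
      ∎
    where
    open ℕₚ.≤-Reasoning
    blocked : Fin n → ℕ
    blocked a = ∑[ j ← allFin r ] (𝟙 (not (adjacentToChosen G i a j (lookup s j))))
    extends-or-blocked : ∀ a → 1 ≤ℕ 𝟙 (isClique G (s [ i ]≔ just a)) ℕ.+ blocked a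
    extends-or-blocked a with allB (λ j → adjacentToChosen G i a j (lookup s j)) (allFin r) in all-adjacent
    ... | true  = subst (λ b → 1 ≤ℕ 𝟙 b ℕ.+ blocked a) (sym extended) (ℕₚ.m≤m+n 1 (blocked a))
      where
      extended : isClique G (s [ i ]≔ just a) ≡ true
      extended = IsClique⇒isClique G (s [ i ]≔ just a)
                   (IsClique-extend G i s s-i≡nothing a (isClique⇒IsClique G s clique)
                                    (λ j → allB-true all-adjacent (∈-allFin j)))
    ... | false = ℕₚ.≤-trans (subst (λ b → 𝟙 (not b) ≤ℕ blocked a) all-adjacent
                                    (𝟙-not-allB≤∑-𝟙-not _ (allFin r)))
                             (ℕₚ.m≤n+m (blocked a) _)

  nonNeighbours≤δn : ∀ {δ} → 0ℚ ≤ δ → MinPartDegreeAtLeast G δ →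
                     ∀ s → lookup s i ≡ nothing → ∀ j → fromℕ (nonNeighbours s j) ≤ δ * fromℕ n
  nonNeighbours≤δn {δ} 0≤δ minDegree s s-i≡nothing j with lookup s j in s-j
  ... | nothing = subst (λ m → fromℕ m ≤ δ * fromℕ n) (sym (trans (∑-allFin-const n 0) (ℕₚ.*-zeroʳ n)))
                        (0≤* 0≤δ (0≤fromℕ n))
  ... | just b  = x+y≡z∧[1-δ]z≤y⇒x≤δz {δ = δ}
                    (trans (sym (fromℕ-+ non (deg G j b i))) (cong fromℕ non+deg≡n))
                    (minDegree j i b j≢i)
    where
    j≢i : j ≢ i
    j≢i j≡i = nothing≢just (trans (sym s-i≡nothing) (subst (λ x → lookup s x ≡ just b) j≡i s-j))
    non : ℕ
    non = ∑[ a ← allFin n ] (𝟙 (not (adj G j b i a)))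
    non+deg≡n : non ℕ.+ deg G j b i ≡ n
    non+deg≡n = trans (cong (non ℕ.+_) (length-filter (adj G j b i) (allFin n)))
                      (trans (∑-𝟙-not+∑-𝟙 (adj G j b i) (allFin n)) (length-allFin n))

  n*𝟙≤[1+2δr]*extensions : ∀ {δ} → 0ℚ ≤ δ → fromℕ (2 *ℕ r) * δ ≤ 1ℚ → MinPartDegreeAtLeast G δ →
                            ∀ s → lookup s i ≡ nothing →
                            fromℕ (n *ℕ 𝟙 (isClique G s)) ≤ (1ℚ + fromℕ 2 * δ * fromℕ r) * fromℕ (extensions s)
  n*𝟙≤[1+2δr]*extensions {δ} 0≤δ 2rδ≤1 minDegree s s-i≡nothing =
    fromℕ-*𝟙-≤ {n} {extensions s} {1+2δr} (isClique G s)
               (0≤* (0≤1+2δr {δ} {fromℕ r} 0≤δ (0≤fromℕ r)) (0≤fromℕ (extensions s))) λ clique →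
      n≤c+δnr⇒n≤[1+2δr]c {δ} {fromℕ r} {fromℕ n} {fromℕ (extensions s)}
                         0≤δ (0≤fromℕ r) (0≤fromℕ n) 2rδ≤1′ (n≤ext+δnr clique)
    where
    open ≤-Reasoning
    1+2δr : ℚ
    1+2δr = 1ℚ + fromℕ 2 * δ * fromℕ r
    2rδ≤1′ : fromℕ 2 * fromℕ r * δ ≤ 1ℚ
    2rδ≤1′ = subst (λ q → q * δ ≤ 1ℚ) (fromℕ-* 2 r) 2rδ≤1
    nonNeighbours≤δn*1 : ∀ j → fromℕ (nonNeighbours s j) ≤ δ * fromℕ n * fromℕ 1
    nonNeighbours≤δn*1 j = subst (fromℕ (nonNeighbours s j) ≤_) (sym (*-identityʳ (δ * fromℕ n)))
                                 (nonNeighbours≤δn 0≤δ minDegree s s-i≡nothing j)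
    ∑nonNeighbours≤δnr : fromℕ (∑[ j ← allFin r ] (nonNeighbours s j)) ≤ δ * fromℕ n * fromℕ r
    ∑nonNeighbours≤δnr =
      subst (λ m → fromℕ (∑[ j ← allFin r ] (nonNeighbours s j)) ≤ δ * fromℕ n * fromℕ m)
            (trans (∑-allFin-const r 1) (ℕₚ.*-identityʳ r))
            (fromℕ-∑-≤ (δ * fromℕ n) (All.universal nonNeighbours≤δn*1 (allFin r)))
    n≤ext+δnr : isClique G s ≡ true → fromℕ n ≤ fromℕ (extensions s) + δ * fromℕ n * fromℕ r
    n≤ext+δnr clique = begin
      fromℕ n
        ≤⟨ fromℕ-mono-≤ (n≤extensions+∑nonNeighbours s s-i≡nothing clique) ⟩
      fromℕ (extensions s ℕ.+ ∑[ j ← allFin r ] (nonNeighbours s j))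
        ≡⟨ fromℕ-+ (extensions s) _ ⟩
      fromℕ (extensions s) + fromℕ (∑[ j ← allFin r ] (nonNeighbours s j))
        ≤⟨ +-monoʳ-≤ (fromℕ (extensions s)) ∑nonNeighbours≤δnr ⟩
      fromℕ (extensions s) + δ * fromℕ n * fromℕ r
        ∎

lookup-p-x : ∀ {r} (p : Subset r) x → lookup (p - x) x ≡ outside
lookup-p-x (b ∷ p) zero    = refl
lookup-p-x (b ∷ p) (suc x) = lookup-p-x p x

x∷p-zero≡outside∷p : ∀ {r x} (p : Subset r) → (x ∷ p) - zero ≡ outside ∷ p
x∷p-zero≡outside∷p p = cong (outside ∷_) (p─⊥≡p p)

selections-outside : ∀ {r} n (J : Subset r) {i} → lookup J i ≡ outside →
                     All (λ s → lookup s i ≡ nothing) (selections n J)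
selections-outside n (inside  ∷ J) {zero}  ()
selections-outside n (outside ∷ J) {zero}  _ = map⁺ (All.universal (λ _ → refl) (selections n J))
selections-outside n (outside ∷ J) {suc i} J-i = map⁺ (selections-outside n J J-i)
selections-outside n (inside  ∷ J) {suc i} J-i =
  concat⁺ (map⁺ (All.map (λ s-i → map⁺ (All.universal (λ _ → s-i) (allFin n))) (selections-outside n J J-i)))

∑-selections-inside : ∀ {r} n (I : Subset r) (f : Vec (Maybe (Fin n)) (ℕ.suc r) → ℕ) →
                      ∑ (selections n (inside ∷ I)) f
                        ≡ ∑[ s ← selections n I ] (∑[ a ← allFin n ] (f (just a ∷ s)))
∑-selections-inside n I f =
  trans (∑-concatMap _ (selections n I) f)
        (∑-cong (selections n I) (λ s → ∑-map (λ a → just a ∷ s) (allFin n) f))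

∑-selections-split : ∀ {r} n (I : Subset r) {i} → i ∈ I → (f : Vec (Maybe (Fin n)) r → ℕ) →
                     ∑ (selections n I) f
                       ≡ ∑[ s ← selections n (I - i) ] (∑[ a ← allFin n ] (f (s [ i ]≔ just a)))
∑-selections-split n (inside ∷ I) {zero} here f = begin
  ∑ (selections n (inside ∷ I)) f
    ≡⟨ ∑-selections-inside n I f ⟩
  ∑[ s ← selections n I ] (∑[ a ← allFin n ] (f (just a ∷ s)))
    ≡⟨ sym (∑-map (nothing ∷_) (selections n I) extend₀) ⟩
  ∑ (selections n (outside ∷ I)) extend₀
    ≡⟨ cong (λ J → ∑ (selections n J) extend₀) (sym (x∷p-zero≡outside∷p {x = inside} I)) ⟩
  ∑ (selections n ((inside ∷ I) - zero)) extend₀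
    ∎
  where
  open ≡-Reasoning
  extend₀ : Vec (Maybe (Fin n)) _ → ℕ
  extend₀ s = ∑[ a ← allFin n ] (f (s [ zero ]≔ just a))
∑-selections-split n (outside ∷ I) {suc i} (there i∈I) f =
  trans (∑-map (nothing ∷_) (selections n I) f)
        (trans (∑-selections-split n I i∈I (λ s → f (nothing ∷ s)))
               (sym (∑-map (nothing ∷_) (selections n (I - i)) _)))
∑-selections-split n (inside ∷ I) {suc i} (there i∈I) f = begin
  ∑ (selections n (inside ∷ I)) f
    ≡⟨ ∑-selections-inside n I f ⟩
  ∑[ s ← selections n I ] (∑[ a ← allFin n ] (f (just a ∷ s)))
    ≡⟨ ∑-comm (selections n I) (allFin n) _ ⟩
  ∑[ a ← allFin n ] (∑[ s ← selections n I ] (f (just a ∷ s)))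
    ≡⟨ ∑-cong (allFin n) (λ a → ∑-selections-split n I i∈I (λ s → f (just a ∷ s))) ⟩
  ∑[ a ← allFin n ] (∑[ s ← selections n (I - i) ] (∑[ b ← allFin n ] (f (just a ∷ (s [ i ]≔ just b)))))
    ≡⟨ ∑-comm (allFin n) (selections n (I - i)) _ ⟩
  ∑[ s ← selections n (I - i) ] (∑[ a ← allFin n ] (∑[ b ← allFin n ] (f (just a ∷ (s [ i ]≔ just b)))))
    ≡⟨ sym (∑-selections-inside n (I - i) _) ⟩
  ∑ (selections n (inside ∷ (I - i))) (λ s → ∑[ b ← allFin n ] (f (s [ suc i ]≔ just b))) ∎
  where open ≡-Reasoning

proposition3p2 : (r n : ℕ) → 3 ≤ℕ r → (δ : ℚ) → 0ℚ ≤ δ → (+ (2 *ℕ r) / 1) * δ ≤ 1ℚ →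
  (G : RPartiteGraph r n) → MinPartDegreeAtLeast G δ →
  (I : Subset r) (i : Fin r) → i ∈ I →
    (k G I ≤ℕ n *ℕ k G (I - i))
    × (+ (n *ℕ k G (I - i)) / 1 ≤ (1ℚ + (+ 2 / 1) * δ * (+ r / 1)) * (+ k G I / 1))
proposition3p2 r n _ δ 0≤δ 2rδ≤1 G minDegree I i i∈I = lower , upper
  where
  S : List (Vec (Maybe (Fin n)) r)
  S = selections n (I - i)
  1+2δr : ℚ
  1+2δr = 1ℚ + fromℕ 2 * δ * fromℕ r
  free : All (λ s → lookup s i ≡ nothing) S
  free = selections-outside n (I - i) (lookup-p-x I i)
  k[I]≡∑extensions : k G I ≡ ∑ S (extensions G i)
  k[I]≡∑extensions = trans (length-filter (isClique G) (selections n I))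
                           (∑-selections-split n I i∈I (λ s → 𝟙 (isClique G s)))
  n*k[I-i]≡∑ : n *ℕ k G (I - i) ≡ ∑[ s ← S ] (n *ℕ 𝟙 (isClique G s))
  n*k[I-i]≡∑ = trans (cong (n *ℕ_) (length-filter (isClique G) S)) (*-distribˡ-∑ n S _)
  lower : k G I ≤ℕ n *ℕ k G (I - i)
  lower = subst₂ _≤ℕ_ (sym k[I]≡∑extensions) (sym n*k[I-i]≡∑)
                 (∑-mono-All (All.map (λ {s} → extensions≤n*𝟙 G i s) free))
  upper : fromℕ (n *ℕ k G (I - i)) ≤ 1+2δr * fromℕ (k G I)
  upper = subst₂ (λ x y → fromℕ x ≤ 1+2δr * fromℕ y) (sym n*k[I-i]≡∑) (sym k[I]≡∑extensions)
                 (fromℕ-∑-≤ 1+2δr (All.map (λ {s} → n*𝟙≤[1+2δr]*extensions G i 0≤δ 2rδ≤1 minDegree s)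
                                           free))
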